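{- Let $\mathcal T$ be an extensional typed combinatory algebra. If $\mathcal{T}$ is standard, then $N$ (with $\mathsf 0$ and $\mathsf{succ}$) is a natural numbers object in the category $\mathcal{T}$, and this natural numbers object is preserved by the functor $E:\mathcal T\to\mathbf{Asm}_{\mathcal T}$.
   Context: A typed combinatory algebra (tca) $\mathcal{T}$ consists of a set of types containing $\bot,\top,N$ and closed under $\times,\to,+$; sets $|T|$; total application maps $|S\to T|\times|S|\to|T|$, $(a,b)\mapsto ab$; and elements $\mathsf{exf},\mathsf t,\mathsf k,\mathsf s,\mathsf{pair},\mathsf{fst},\mathsf{snd},\mathsf{inl},\mathsf{inr},\mathsf{case},\mathsf 0\in|N|,\mathsf{succ}\in|N\to N|,\mathsf R$ of the appropriate types satisfying $\mathsf{k}ab=a$, $\mathsf{s}abc=ac(bc)$, $\mathsf{fst}(\mathsf{pair}ab)=a$, $\mathsf{snd}(\mathsf{pair}ab)=b$, $\mathsf{case}ab(\mathsf{inl}x)=ax$, $\mathsf{case}ab(\mathsf{inr}x)=bx$, $\mathsf{R}ab\mathsf{0}=a$, $\mathsf{R}ab(\mathsf{succ}n)=bn(\mathsf{R}abn)$. $\mathcal T$ is standard if $n\mapsto\overline n=\mathsf{succ}^n\mathsf 0$ is a bijection $\mathbb N\to|N|$; extensional if the maps $|S\times T|\to|S|\times|T|$, $x\mapsto(\mathsf{fst}x,\mathsf{snd}x)$ and $|T\to S|\to|S|^{|T|}$, $x\mapsto(y\mapsto xy)$ are injective and $|\top|=\{\mathsf t\}$. For extensional $\mathcal T$, the category also denoted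 $\mathcal T$ has the types as objects and elements of $|A\to B|$ as morphisms (a cartesian closed category with terminal object $\top$). Assemblies over $\mathcal T$ are triples $(X,A,\alpha)$ with $\alpha(x)\subseteq|A|$ inhabited; morphisms are tracked functions; $\mathbf{Asm}_{\mathcal T}$ has natural numbers object $(\mathbb N,N,n\mapsto\{\overline n\})$. $E$ sends $A$ to $(|A|,A,x\mapsto\{x\})$ and $f$ to $x\mapsto fx$. -}

module Defs where

open import Data.Nat using (ℕ)
open import Data.Product using (Σ; ∃; _×_; _,_; proj₁; proj₂)
open import Function.Definitions using (Bijective)
open import Relation.Binary.PropositionalEquality using (_≡_; refl; cong; trans; sym; subst)

record TCA : Set₁ where
  infixr 7 _⇒_
  infixr 8 _`×_ _`+_
  infixl 9 _·_
  field
    Ty   : Set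
    `⊥ `⊤ `N : Ty
    _`×_ _⇒_ _`+_ : Ty → Ty → Ty
    ∣_∣  : Ty → Set
    _·_  : ∀ {S T} → ∣ S ⇒ T ∣ → ∣ S ∣ → ∣ T ∣
    exf  : ∀ {A} → ∣ `⊥ ⇒ A ∣
    t    : ∣ `⊤ ∣
    k    : ∀ {A B} → ∣ A ⇒ B ⇒ A ∣
    s    : ∀ {A B C} → ∣ (A ⇒ B ⇒ C) ⇒ (A ⇒ B) ⇒ A ⇒ C ∣
    pair : ∀ {A B} → ∣ A ⇒ B ⇒ A `× B ∣
    fst  : ∀ {A B} → ∣ A `× B ⇒ A ∣
    snd  : ∀ {A B} → ∣ A `× B ⇒ B ∣
    inl  : ∀ {A B} → ∣ A ⇒ A `+ B ∣
    inr  : ∀ {A B} → ∣ B ⇒ A `+ B ∣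
    case : ∀ {A B C} → ∣ (A ⇒ C) ⇒ (B ⇒ C) ⇒ A `+ B ⇒ C ∣
    𝟎    : ∣ `N ∣
    succ : ∣ `N ⇒ `N ∣
    R    : ∀ {A} → ∣ A ⇒ (`N ⇒ A ⇒ A) ⇒ `N ⇒ A ∣
    k-eq    : ∀ {A B} (a : ∣ A ∣) (b : ∣ B ∣) → k · a · b ≡ a
    s-eq    : ∀ {A B C} (a : ∣ A ⇒ B ⇒ C ∣) (b : ∣ A ⇒ B ∣) (c : ∣ A ∣) →
              s · a · b · c ≡ a · c · (b · c)
    fst-eq  : ∀ {A B} (a : ∣ A ∣) (b : ∣ B ∣) → fst · (pair · a · b) ≡ a
    snd-eq  : ∀ {A B} (a : ∣ A ∣) (b : ∣ B ∣) → snd · (pair · a · b) ≡ b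
    case-inl : ∀ {A B C} (a : ∣ A ⇒ C ∣) (b : ∣ B ⇒ C ∣) (x : ∣ A ∣) →
               case · a · b · (inl · x) ≡ a · x
    case-inr : ∀ {A B C} (a : ∣ A ⇒ C ∣) (b : ∣ B ⇒ C ∣) (x : ∣ B ∣) →
               case · a · b · (inr · x) ≡ b · x
    R-zero : ∀ {A} (a : ∣ A ∣) (b : ∣ `N ⇒ A ⇒ A ∣) → R · a · b · 𝟎 ≡ a
    R-succ : ∀ {A} (a : ∣ A ∣) (b : ∣ `N ⇒ A ⇒ A ∣) (n : ∣ `N ∣) →
             R · a · b · (succ · n) ≡ b · n · (R · a · b · n)

module _ (𝒯 : TCA) where
  open TCA 𝒯

  numeral : ℕ → ∣ `N ∣
  numeral ℕ.zero    = 𝟎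
  numeral (ℕ.suc n) = succ · numeral n

  Standard : Set
  Standard = Bijective _≡_ _≡_ numeral

  record Extensional : Set where
    field
      pair-inj : ∀ {S T} (x y : ∣ S `× T ∣) →
                 fst · x ≡ fst · y → snd · x ≡ snd · y → x ≡ y
      fun-inj  : ∀ {T S} (x y : ∣ T ⇒ S ∣) → (∀ z → x · z ≡ y · z) → x ≡ y
      ⊤-single : ∀ (x : ∣ `⊤ ∣) → x ≡ t

  Hom : Ty → Ty → Set
  Hom A B = ∣ A ⇒ B ∣

  _∘T_ : ∀ {A B C} → Hom B C → Hom A B → Hom A C
  f ∘T g = s · (k · f) · g

  zeroM : Hom `⊤ `N
  zeroM = k · 𝟎

  IsNNO-T : (z : Hom `⊤ `N) (sc : Hom `N `N) → Set
  IsNNO-T z sc =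
    ∀ (A : Ty) (a : Hom `⊤ A) (f : Hom A A) →
      Σ (Hom `N A) λ h →
        ((h ∘T z ≡ a) × (h ∘T sc ≡ f ∘T h)) ×
        (∀ (h' : Hom `N A) → h' ∘T z ≡ a → h' ∘T sc ≡ f ∘T h' → h' ≡ h)

  record Asm : Set₁ where
    field
      Car : Set
      Typ : Ty
      α   : Car → ∣ Typ ∣ → Set
      inh : ∀ x → ∃ (α x)
  open Asm public

  record AsmHom (X Y : Asm) : Set where
    field
      fun     : Car X → Car Y
      tracked : Σ ∣ Typ X ⇒ Typ Y ∣ λ r →
                  ∀ (x : Car X) (a : ∣ Typ X ∣) → α X x a → α Y (fun x) (r · a)
  open AsmHom public

  _≈A_ : ∀ {X Y} → AsmHom X Y → AsmHom X Y → Set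
  _≈A_ {X} f g = ∀ (x : Car X) → fun f x ≡ fun g x

  _∘A_ : ∀ {X Y Z} → AsmHom Y Z → AsmHom X Y → AsmHom X Z
  fun (f ∘A g) x = fun f (fun g x)
  tracked (_∘A_ {X} {Y} {Z} f g) =
    let (rf , pf) = tracked f ; (rg , pg) = tracked g in
    s · (k · rf) · rg ,
    λ x a p → subst (α Z (fun f (fun g x)))
                    (sym (trans (s-eq (k · rf) rg a) (cong (λ u → u · (rg · a)) (k-eq rf a))))
                    (pf (fun g x) (rg · a) (pg x a p))

  IsTerminal-Asm : Asm → Set₁
  IsTerminal-Asm One =
    ∀ (X : Asm) → Σ (AsmHom X One) λ u → ∀ (u' : AsmHom X One) → u' ≈A u

  IsNNO-Asm : {One Nat : Asm} → AsmHom One Nat → AsmHom Nat Nat → Set₁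
  IsNNO-Asm {One} {Nat} z sc =
    ∀ (X : Asm) (a : AsmHom One X) (f : AsmHom X X) →
      Σ (AsmHom Nat X) λ h →
        ((h ∘A z) ≈A a × (h ∘A sc) ≈A (f ∘A h)) ×
        (∀ (h' : AsmHom Nat X) → (h' ∘A z) ≈A a → (h' ∘A sc) ≈A (f ∘A h') → h' ≈A h)

  E₀ : Ty → Asm
  Car (E₀ A) = ∣ A ∣
  Typ (E₀ A) = A
  α   (E₀ A) x a = a ≡ x
  inh (E₀ A) x = x , refl

  E₁ : ∀ {A B} → Hom A B → AsmHom (E₀ A) (E₀ B)
  fun (E₁ f) x = f · x
  tracked (E₁ f) = f , λ x a p → cong (f ·_) p

  PreservedByE : Set₁
  PreservedByE = IsTerminal-Asm (E₀ `⊤) × IsNNO-Asm (E₁ zeroM) (E₁ succ)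

-- Under standardness every element of N is a numeral, so two maps out of N that agree
-- at 0 and commute with succ agree everywhere; this gives uniqueness both in 𝒯
-- (through extensionality) and in assemblies. Existence in 𝒯 is iteration with the
-- recursor, R a (k f). In assemblies the mediating function iterates the given
-- endofunction on the natural number that an element of N denotes, and it is tracked
-- by the same recursor term built from the realizers.
{-# OPTIONS --safe #-}
module Submission where

open import Defs
open import Data.Nat using (ℕ; zero; suc)
open import Data.Product using (_×_; _,_; proj₁; proj₂)
open import Function.Definitions using (Surjective)
open import Relation.Binary.PropositionalEquality
  using (_≡_; refl; sym; trans; cong; subst; module ≡-Reasoning)

iterate : {C : Set} → (C → C) → C → ℕ → C
iterate F c zero    = c
iterate F c (suc m) = F (iterate F c m)

module Combinators (𝒯 : TCA) where
  open TCA 𝒯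

  ∘T-· : ∀ {A B C} (f : ∣ B ⇒ C ∣) (g : ∣ A ⇒ B ∣) x → (_∘T_ 𝒯 f g) · x ≡ f · (g · x)
  ∘T-· f g x = trans (s-eq (k · f) g x) (cong (_· (g · x)) (k-eq f x))

  ∘T-zeroM : ∀ {A} (h : ∣ `N ⇒ A ∣) x → (_∘T_ 𝒯 h (zeroM 𝒯)) · x ≡ h · 𝟎
  ∘T-zeroM h x = trans (∘T-· h (zeroM 𝒯) x) (cong (h ·_) (k-eq 𝟎 x))

  iterR : ∀ {A} → ∣ A ∣ → ∣ A ⇒ A ∣ → ∣ `N ⇒ A ∣
  iterR a f = R · a · (k · f)

  iterR-zero : ∀ {A} (a : ∣ A ∣) (f : ∣ A ⇒ A ∣) → iterR a f · 𝟎 ≡ a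
  iterR-zero a f = R-zero a (k · f)

  iterR-succ : ∀ {A} (a : ∣ A ∣) (f : ∣ A ⇒ A ∣) n →
               iterR a f · (succ · n) ≡ f · (iterR a f · n)
  iterR-succ a f n = trans (R-succ a (k · f) n) (cong (_· (iterR a f · n)) (k-eq f n))

  iterR-tracks-iterate : (X : Asm 𝒯) (F : Car X → Car X) (rF : ∣ Typ X ⇒ Typ X ∣) →
    (∀ x b → α X x b → α X (F x) (rF · b)) →
    ∀ {x₀ b₀} → α X x₀ b₀ → ∀ m → α X (iterate F x₀ m) (iterR b₀ rF · numeral 𝒯 m)
  iterR-tracks-iterate X F rF tracksF {x₀} {b₀} b₀⊩x₀ = go
    where
    go : ∀ m → α X (iterate F x₀ m) (iterR b₀ rF · numeral 𝒯 m)
    go zero    = subst (α X x₀) (sym (iterR-zero b₀ rF)) b₀⊩x₀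
    go (suc m) = subst (α X (iterate F x₀ (suc m)))
                   (sym (iterR-succ b₀ rF (numeral 𝒯 m)))
                   (tracksF _ _ (go m))

module SurjectiveNumerals (𝒯 : TCA) (surj : Surjective _≡_ _≡_ (numeral 𝒯)) where
  open TCA 𝒯

  N-induction : (P : ∣ `N ∣ → Set) → (∀ m → P (numeral 𝒯 m)) → ∀ n → P n
  N-induction P P-numeral n = subst P (proj₂ (surj n) refl) (P-numeral (proj₁ (surj n)))

  N-recursion-unique : {C : Set} (F : C → C) (φ ψ : ∣ `N ∣ → C) → φ 𝟎 ≡ ψ 𝟎 →
    (∀ n → φ (succ · n) ≡ F (φ n)) → (∀ n → ψ (succ · n) ≡ F (ψ n)) →
    ∀ n → φ n ≡ ψ n
  N-recursion-unique F φ ψ φ𝟎≡ψ𝟎 φ-succ ψ-succ = N-induction _ go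
    where
    go : ∀ m → φ (numeral 𝒯 m) ≡ ψ (numeral 𝒯 m)
    go zero    = φ𝟎≡ψ𝟎
    go (suc m) = trans (φ-succ _) (trans (cong F (go m)) (sym (ψ-succ _)))

module StandardNumerals (𝒯 : TCA) (std : Standard 𝒯) where
  open TCA 𝒯

  toℕ : ∣ `N ∣ → ℕ
  toℕ n = proj₁ (proj₂ std n)

  numeral-toℕ : ∀ n → numeral 𝒯 (toℕ n) ≡ n
  numeral-toℕ n = proj₂ (proj₂ std n) refl

  toℕ-numeral : ∀ m → toℕ (numeral 𝒯 m) ≡ m
  toℕ-numeral m = proj₁ std (numeral-toℕ (numeral 𝒯 m))

  toℕ-succ : ∀ n → toℕ (succ · n) ≡ suc (toℕ n)
  toℕ-succ n = begin
    toℕ (succ · n)                       ≡⟨ cong (λ x → toℕ (succ · x)) (sym (numeral-toℕ n)) ⟩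
    toℕ (numeral 𝒯 (suc (toℕ n)))        ≡⟨ toℕ-numeral (suc (toℕ n)) ⟩
    suc (toℕ n)                          ∎
    where open ≡-Reasoning

module _ (𝒯 : TCA) (ext : Extensional 𝒯) where
  open TCA 𝒯
  open Extensional ext
  open Combinators 𝒯

  N-isNNO : Surjective _≡_ _≡_ (numeral 𝒯) → IsNNO-T 𝒯 (zeroM 𝒯) succ
  N-isNNO surj A a f = h , (h∘0≡a , h∘succ≡f∘h) , unique
    where
    open SurjectiveNumerals 𝒯 surj
    h : ∣ `N ⇒ A ∣
    h = iterR (a · t) f
    h∘0≡a : _∘T_ 𝒯 h (zeroM 𝒯) ≡ a
    h∘0≡a = fun-inj _ _ λ x →
      trans (∘T-zeroM h x) (trans (iterR-zero (a · t) f) (cong (a ·_) (sym (⊤-single x))))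
    h∘succ≡f∘h : _∘T_ 𝒯 h succ ≡ _∘T_ 𝒯 f h
    h∘succ≡f∘h = fun-inj _ _ λ n →
      trans (∘T-· h succ n) (trans (iterR-succ (a · t) f n) (sym (∘T-· f h n)))
    unique : ∀ h' → _∘T_ 𝒯 h' (zeroM 𝒯) ≡ a → _∘T_ 𝒯 h' succ ≡ _∘T_ 𝒯 f h' → h' ≡ h
    unique h' h'∘0≡a h'∘succ≡f∘h' = fun-inj _ _ (N-recursion-unique (f ·_) (h' ·_) (h ·_)
      (trans (sym (∘T-zeroM h' t)) (trans (cong (_· t) h'∘0≡a) (sym (iterR-zero (a · t) f))))
      (λ n → trans (sym (∘T-· h' succ n)) (trans (cong (_· n) h'∘succ≡f∘h') (∘T-· f h' n)))
      (iterR-succ (a · t) f))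

  E⊤-terminal : IsTerminal-Asm 𝒯 (E₀ 𝒯 `⊤)
  E⊤-terminal X = ! , λ _ _ → ⊤-single _
    where
    ! : AsmHom 𝒯 X (E₀ 𝒯 `⊤)
    AsmHom.fun !     _ = t
    AsmHom.tracked ! = k · t , λ _ b _ → k-eq t b

  EN-isNNO : Standard 𝒯 → IsNNO-Asm 𝒯 (E₁ 𝒯 (zeroM 𝒯)) (E₁ 𝒯 succ)
  EN-isNNO std X a f = h , (h∘0≈a , h∘succ≈f∘h) , unique
    where
    open StandardNumerals 𝒯 std
    open SurjectiveNumerals 𝒯 (proj₂ std)
    F : Car X → Car X
    F = AsmHom.fun f
    x₀ : Car X
    x₀ = AsmHom.fun a t
    rf : ∣ Typ X ⇒ Typ X ∣
    rf = proj₁ (AsmHom.tracked f)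
    b₀ : ∣ Typ X ∣
    b₀ = proj₁ (AsmHom.tracked a) · t
    b₀⊩x₀ : α X x₀ b₀
    b₀⊩x₀ = proj₂ (AsmHom.tracked a) t t refl
    φ : ∣ `N ∣ → Car X
    φ n = iterate F x₀ (toℕ n)
    φ-zero : φ 𝟎 ≡ x₀
    φ-zero = cong (iterate F x₀) (toℕ-numeral 0)
    φ-succ : ∀ n → φ (succ · n) ≡ F (φ n)
    φ-succ n = cong (iterate F x₀) (toℕ-succ n)
    h : AsmHom 𝒯 (E₀ 𝒯 `N) X
    AsmHom.fun h = φ
    AsmHom.tracked h = iterR b₀ rf , λ n b b≡n →
      subst (λ c → α X (φ n) (iterR b₀ rf · c)) (trans (numeral-toℕ n) (sym b≡n))
        (iterR-tracks-iterate X F rf (proj₂ (AsmHom.tracked f)) b₀⊩x₀ (toℕ n))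
    h∘0≈a : _≈A_ 𝒯 (_∘A_ 𝒯 h (E₁ 𝒯 (zeroM 𝒯))) a
    h∘0≈a x = trans (cong φ (k-eq 𝟎 x)) (trans φ-zero (cong (AsmHom.fun a) (sym (⊤-single x))))
    h∘succ≈f∘h : _≈A_ 𝒯 (_∘A_ 𝒯 h (E₁ 𝒯 succ)) (_∘A_ 𝒯 f h)
    h∘succ≈f∘h = φ-succ
    unique : ∀ h' → _≈A_ 𝒯 (_∘A_ 𝒯 h' (E₁ 𝒯 (zeroM 𝒯))) a →
             _≈A_ 𝒯 (_∘A_ 𝒯 h' (E₁ 𝒯 succ)) (_∘A_ 𝒯 f h') → _≈A_ 𝒯 h' h
    unique h' h'∘0≈a h'∘succ≈f∘h' = N-recursion-unique F (AsmHom.fun h') φ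
      (trans (sym (cong (AsmHom.fun h') (k-eq 𝟎 t))) (trans (h'∘0≈a t) (sym φ-zero)))
      h'∘succ≈f∘h' φ-succ

mainTheorem14 : (𝒯 : TCA) → Extensional 𝒯 → Standard 𝒯 →
    IsNNO-T 𝒯 (zeroM 𝒯) (TCA.succ 𝒯) × PreservedByE 𝒯
mainTheorem14 𝒯 ext std = N-isNNO 𝒯 ext (proj₂ std) , E⊤-terminal 𝒯 ext , EN-isNNO 𝒯 ext std
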